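{- Let $i\ge1$, $n\ge1$ and $\alpha\le\omega^i$. Then $\mathfrak S_\alpha\cup\{uv\mid u\in\mathsf{leaves}(\mathfrak S_\alpha),\ v\in\mathfrak S_{\omega^i\cdot n}\}=\mathfrak S_{\omega^i\cdot n+\alpha}$.
   Context: Fundamental sequences: every limit ordinal $\alpha<\omega^\omega$ has Cantor normal form $\alpha=\omega^{e_j}n_j+\dots+\omega^{e_1}n_1$ with $e_j>\dots>e_1>0$, $n_l>0$; its fundamental sequence is $\alpha_k=\omega^{e_j}n_j+\dots+\omega^{e_2}n_2+\omega^{e_1}(n_1-1)+\omega^{e_1-1}k+1$ ($k\ge1$). Sets $\mathfrak S_\alpha\subseteq\mathbb N_{>0}^*$ for $\alpha<\omega^\omega$: $\mathfrak S_0=\{\varepsilon\}$; $\mathfrak S_{\beta+1}=\{\varepsilon\}\cup\{mu\mid m\in\mathbb N_{>0},u\in\mathfrak S_\beta\}$; for limit $\alpha$, $\mathfrak S_\alpha=\{\varepsilon\}\cup\{ku\mid k\in\mathbb N_{>0},u\in\mathfrak S_{\alpha_k}\}$. These are regarded as trees under the inverse prefix order; $\mathsf{leaves}(\mathfrak S_\alpha)$ is the set of words in $\mathfrak S_\alpha$ that are not proper prefixes of other words in $\mathfrak S_\alpha$. -}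

module Defs where

open import Data.Nat using (ℕ; zero; suc; _+_; _<_; _<ᵇ_; _⊔_; NonZero)
open import Data.List using (List; []; _∷_; _++_; replicate; applyUpTo; length)
open import Data.Maybe using (Maybe; just; nothing)
import Data.Maybe as Maybe
open import Data.Bool using (if_then_else_)
open import Data.Product using (Σ; _×_; ∃)
open import Data.Sum using (_⊎_)
open import Data.Unit using (⊤)
open import Data.Empty using (⊥)
open import Relation.Binary.PropositionalEquality using (_≡_; _≢_)
open import Relation.Nullary using (¬_)

-- Ordinals below ω^ω in Cantor normal form, given by their coefficient
-- list from the lowest exponent upward: [c₀, c₁, …, c_d] denotes
-- ω^d·c_d + … + ω^1·c₁ + c₀.  Trailing zeros are allowed (and harmless).
Ord : Set
Ord = List ℕ

coef : Ord → ℕ → ℕ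
coef []       _       = 0
coef (c ∷ cs) zero    = c
coef (c ∷ cs) (suc e) = coef cs e

ωpow* : ℕ → ℕ → Ord
ωpow* i n = replicate i 0 ++ (n ∷ [])

ωpow : ℕ → Ord
ωpow i = ωpow* i 1

_≈o_ : Ord → Ord → Set
α ≈o β = ∀ e → coef α e ≡ coef β e

_<o_ : Ord → Ord → Set
α <o β = Σ ℕ λ e → (coef α e < coef β e) × (∀ e' → e < e' → coef α e' ≡ coef β e')

_≤o_ : Ord → Ord → Set
α ≤o β = (α <o β) ⊎ (α ≈o β)

top : Ord → Maybe ℕ
top []       = nothing
top (c ∷ cs) with top cs
... | just d  = just (suc d)
... | nothing with c
...   | zero  = nothing
...   | suc _ = just 0

-- ordinal addition α + β (in CNF: the terms of α below the leading exponent
-- of β are absorbed)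
_+o_ : Ord → Ord → Ord
α +o β with top β
... | nothing = α
... | just d  = applyUpTo f (suc (length α ⊔ d))
  where
  f : ℕ → ℕ
  f e = if e <ᵇ d then coef β e
        else (if d <ᵇ e then coef α e else coef α e + coef β e)

-- Step along a letter m (≥ 1) of a word.
--  * α = 0          : nothing
--  * α = β + 1      : β
--  * α limit        : the fundamental sequence element α_m
-- For α limit with lowest nonzero exponent e₁ > 0,
--  α_m = … + ω^{e₁}(n₁ - 1) + ω^{e₁-1}·m + 1.
-- limAux m cs : cs are the coefficients of exponents ≥ 1 (exponent 0 is 0);
-- returns coefficients from exponent 0 with c_{e₁} decremented and m
-- placed at exponent e₁-1.
limAux : ℕ → List ℕ → Maybe Ord
limAux m []           = nothing
limAux m (suc c ∷ cs) = just (m ∷ c ∷ cs)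
limAux m (zero ∷ cs)  = Maybe.map (0 ∷_) (limAux m cs)

inc0 : Ord → Ord
inc0 []       = 1 ∷ []
inc0 (x ∷ xs) = suc x ∷ xs

next : ℕ → Ord → Maybe Ord
next m []           = nothing
next m (suc c ∷ cs) = just (c ∷ cs)
next m (zero ∷ cs)  = Maybe.map inc0 (limAux m cs)

Word : Set
Word = List ℕ

mutual
  _∈𝔖_ : Word → Ord → Set
  []      ∈𝔖 α = ⊤
  (m ∷ u) ∈𝔖 α = NonZero m × stepIn u (next m α)

  stepIn : Word → Maybe Ord → Set
  stepIn u nothing  = ⊥
  stepIn u (just β) = u ∈𝔖 β

_∈leaves_ : Word → Ord → Set
u ∈leaves α = (u ∈𝔖 α) × ¬ (Σ Word λ v → (v ≢ []) × ((u ++ v) ∈𝔖 α))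

-- Write γ = ω^i·n.  If the Cantor normal form of α has degree at most i, then
-- γ + α is the termwise sum γ ⊕ α, and for nonzero α a step along a letter m
-- (predecessor or fundamental sequence) commutes with adding γ:
-- (γ ⊕ α)[m] = γ ⊕ α[m].  Hence, by induction on the word, a word walks
-- through 𝔖_{γ+α} exactly as through 𝔖_α until α has been exhausted, i.e. until
-- it sits at a leaf of 𝔖_α, and from there on it walks through 𝔖_γ.
module Submission where

open import Defs
open import Data.Nat using (ℕ; _≥_)
open import Data.List using (_++_)
open import Data.Product using (Σ; _×_)
open import Data.Sum using (_⊎_)
open import Relation.Binary.PropositionalEquality using (_≡_)
open import Function.Bundles using (_⇔_)

open import Data.Bool using (true; false; if_then_else_)
open import Data.Bool.Properties using (T-≡)
open import Data.List using ([]; _∷_; drop; applyUpTo; length)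
open import Data.List.Properties using (length-applyUpTo)
open import Data.List.Relation.Unary.All using (All; []; _∷_)
open import Data.Maybe using (just; nothing)
import Data.Maybe as Maybe
open import Data.Maybe.Relation.Binary.Pointwise using (Pointwise; just; nothing)
open import Data.Nat using (zero; suc; _+_; _<_; _≤_; _<ᵇ_; _⊔_; z≤n; s≤s; NonZero; _<?_)
open import Data.Nat.Properties
open import Data.Product using (∃; _,_; proj₁; proj₂)
open import Data.Product.Function.NonDependent.Propositional using (_×-⇔_)
open import Data.Sum using (inj₁; inj₂)
open import Data.Unit using (tt)
open import Function using (_∘_)
open import Function.Bundles using (mk⇔; Equivalence)
import Function.Properties.Equivalence as ⇔
open import Relation.Binary using (Tri; tri<; tri≈; tri>)
open import Relation.Binary.PropositionalEquality
  using (_≢_; refl; sym; trans; cong; subst; module ≡-Reasoning)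
open import Relation.Nullary using (¬_; yes; no; contradiction)
open import Relation.Nullary.Reflects using (ofʸ)
open ≡-Reasoning

IsZero : Ord → Set
IsZero = All (_≡ 0)

DegreeAtMost : ℕ → Ord → Set
DegreeAtMost i α = IsZero (drop (suc i) α)

IsZero⇒coef≡0 : ∀ {α} → IsZero α → ∀ e → coef α e ≡ 0
IsZero⇒coef≡0 []         e       = refl
IsZero⇒coef≡0 (c≡0 ∷ _)  zero    = c≡0
IsZero⇒coef≡0 (_ ∷ cs≡0) (suc e) = IsZero⇒coef≡0 cs≡0 e

coef≡0⇒IsZero : ∀ α → (∀ e → coef α e ≡ 0) → IsZero α
coef≡0⇒IsZero []       _      = []
coef≡0⇒IsZero (c ∷ cs) vanish = vanish 0 ∷ coef≡0⇒IsZero cs (vanish ∘ suc)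

coef≡0⇒DegreeAtMost : ∀ i α → (∀ e → i < e → coef α e ≡ 0) → DegreeAtMost i α
coef≡0⇒DegreeAtMost i       []       _      = []
coef≡0⇒DegreeAtMost zero    (c ∷ cs) vanish =
  coef≡0⇒IsZero cs (λ e → vanish (suc e) (s≤s z≤n))
coef≡0⇒DegreeAtMost (suc i) (c ∷ cs) vanish =
  coef≡0⇒DegreeAtMost i cs (λ e i<e → vanish (suc e) (s≤s i<e))

DegreeAtMost⇒coef≡0 : ∀ i α → DegreeAtMost i α → ∀ e → i < e → coef α e ≡ 0
DegreeAtMost⇒coef≡0 i       []       _   e       _         = refl
DegreeAtMost⇒coef≡0 zero    (c ∷ cs) deg (suc e) _         = IsZero⇒coef≡0 deg e
DegreeAtMost⇒coef≡0 (suc i) (c ∷ cs) deg (suc e) (s≤s i<e) = DegreeAtMost⇒coef≡0 i cs deg e i<e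

DegreeAtMost-ωpow* : ∀ i n → DegreeAtMost i (ωpow* i n)
DegreeAtMost-ωpow* zero    n = []
DegreeAtMost-ωpow* (suc i) n = DegreeAtMost-ωpow* i n

coef-ωpow*-≢ : ∀ i n {e} → i ≢ e → coef (ωpow* i n) e ≡ 0
coef-ωpow*-≢ zero    n {zero}  i≢e = contradiction refl i≢e
coef-ωpow*-≢ zero    n {suc e} _   = refl
coef-ωpow*-≢ (suc i) n {zero}  _   = refl
coef-ωpow*-≢ (suc i) n {suc e} i≢e = coef-ωpow*-≢ i n (i≢e ∘ cong suc)

-- The natural sum α ⊕ ω^i·n, arranged so that it reduces on the constructors of α.
addTerm : ℕ → ℕ → Ord → Ord
addTerm zero    n []       = n ∷ []
addTerm zero    n (c ∷ cs) = c + n ∷ cs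
addTerm (suc i) n []       = 0 ∷ addTerm i n []
addTerm (suc i) n (c ∷ cs) = c ∷ addTerm i n cs

coef-addTerm : ∀ i n α e → coef (addTerm i n α) e ≡ coef α e + coef (ωpow* i n) e
coef-addTerm zero    n []       zero    = refl
coef-addTerm zero    n []       (suc e) = refl
coef-addTerm zero    n (c ∷ cs) zero    = refl
coef-addTerm zero    n (c ∷ cs) (suc e) = sym (+-identityʳ _)
coef-addTerm (suc i) n []       zero    = refl
coef-addTerm (suc i) n []       (suc e) = coef-addTerm i n [] e
coef-addTerm (suc i) n (c ∷ cs) zero    = sym (+-identityʳ c)
coef-addTerm (suc i) n (c ∷ cs) (suc e) = coef-addTerm i n cs e

ωpow*≈addTerm : ∀ i n {α} → IsZero α → ωpow* i n ≈o addTerm i n α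
ωpow*≈addTerm i n {α} α≡0 e =
  sym (trans (coef-addTerm i n α e) (cong (_+ coef (ωpow* i n) e) (IsZero⇒coef≡0 α≡0 e)))

≤o-DegreeAtMost : ∀ i α β → α ≤o β → DegreeAtMost i β → DegreeAtMost i α
≤o-DegreeAtMost i α β α≤β deg = coef≡0⇒DegreeAtMost i α (vanish α≤β)
  where
  β-vanish = DegreeAtMost⇒coef≡0 i β deg

  vanish : α ≤o β → ∀ e → i < e → coef α e ≡ 0
  vanish (inj₂ α≈β) e i<e = trans (α≈β e) (β-vanish e i<e)
  vanish (inj₁ (e₀ , α<β , agree)) e i<e with e₀ <? e
  ... | yes e₀<e = trans (agree e e₀<e) (β-vanish e i<e)
  ... | no  e₀≮e =
    contradiction (subst (coef α e₀ <_) (β-vanish e₀ (<-≤-trans i<e (≮⇒≥ e₀≮e))) α<β) n≮0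

coef-length : ∀ α {e} → length α ≤ e → coef α e ≡ 0
coef-length []       _           = refl
coef-length (c ∷ cs) (s≤s len≤e) = coef-length cs len≤e

coef-applyUpTo : ∀ (f : ℕ → ℕ) {k e} → e < k → coef (applyUpTo f k) e ≡ f e
coef-applyUpTo f {suc k} {zero}  _         = refl
coef-applyUpTo f {suc k} {suc e} (s≤s e<k) = coef-applyUpTo (f ∘ suc) e<k

top≡nothing⇒IsZero : ∀ α → top α ≡ nothing → IsZero α
top≡nothing⇒IsZero []       _ = []
top≡nothing⇒IsZero (c ∷ cs) t with top cs in t′
... | nothing with c
...   | zero = refl ∷ top≡nothing⇒IsZero cs t′

top≡just : ∀ α {d} → top α ≡ just d → coef α d ≢ 0 × (∀ e → d < e → coef α e ≡ 0)
top≡just (c ∷ cs) t with top cs in t′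
top≡just (c ∷ cs) refl | just d with top≡just cs t′
... | cs[d]≢0 , above = cs[d]≢0 , λ { (suc e) (s≤s d<e) → above e d<e }
top≡just (c ∷ cs) t    | nothing with c
top≡just (c ∷ cs) refl | nothing | suc _ =
  (λ ()) , λ { (suc e) _ → IsZero⇒coef≡0 (top≡nothing⇒IsZero cs t′) e }

+o-top≡nothing : ∀ α β → top β ≡ nothing → α +o β ≡ α
+o-top≡nothing α β t rewrite t = refl

coefSum : Ord → Ord → ℕ → ℕ → ℕ
coefSum α β d e = if e <ᵇ d then coef β e else if d <ᵇ e then coef α e else coef α e + coef β e

<ᵇ≡true : ∀ {m n} → m < n → (m <ᵇ n) ≡ true
<ᵇ≡true m<n = Equivalence.to T-≡ (<⇒<ᵇ m<n)

<ᵇ≡false : ∀ {m n} → ¬ m < n → (m <ᵇ n) ≡ false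
<ᵇ≡false {m} {n} m≮n with m <ᵇ n | <ᵇ-reflects-< m n
... | false | _       = refl
... | true  | ofʸ m<n = contradiction m<n m≮n

coefSum-< : ∀ α β {d e} → e < d → coefSum α β d e ≡ coef β e
coefSum-< α β e<d rewrite <ᵇ≡true e<d = refl

coefSum-≡ : ∀ α β d → coefSum α β d d ≡ coef α d + coef β d
coefSum-≡ α β d rewrite <ᵇ≡false (n≮n d) = refl

coefSum-> : ∀ α β {d e} → d < e → coefSum α β d e ≡ coef α e
coefSum-> α β d<e rewrite <ᵇ≡false (<⇒≯ d<e) | <ᵇ≡true d<e = refl

coef-+o : ∀ α β {d} → top β ≡ just d → ∀ e → coef (α +o β) e ≡ coefSum α β d e
coef-+o α β {d} t e rewrite t with e <? suc (length α ⊔ d)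
... | yes e<k = coef-applyUpTo (coefSum α β d) e<k
... | no  e≮k = begin
  coef (applyUpTo f k) e  ≡⟨ coef-length _ (subst (_≤ e) (sym (length-applyUpTo f k)) k≤e) ⟩
  0                       ≡⟨ coef-length α (≤-trans (m≤m⊔n (length α) d) (<⇒≤ k≤e)) ⟨
  coef α e                ≡⟨ coefSum-> α β (≤-trans (s≤s (m≤n⊔m (length α) d)) k≤e) ⟨
  coefSum α β d e         ∎
  where
  f = coefSum α β d
  k = suc (length α ⊔ d)
  k≤e = ≮⇒≥ e≮k

ωpow*+o≈addTerm : ∀ i n α → DegreeAtMost i α → (ωpow* i n +o α) ≈o addTerm i n α
ωpow*+o≈addTerm i n α deg = byTop (top α) refl
  where
  γ = ωpow* i n

  byTop : ∀ t → top α ≡ t → (γ +o α) ≈o addTerm i n α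
  byTop nothing  t = subst (_≈o addTerm i n α) (sym (+o-top≡nothing γ α t))
                           (ωpow*≈addTerm i n (top≡nothing⇒IsZero α t))
  byTop (just d) t e =
    trans (coef-+o γ α t e) (trans (byCmp (<-cmp e d)) (sym (coef-addTerm i n α e)))
    where
    d≤i : d ≤ i
    d≤i = ≮⇒≥ (λ i<d → proj₁ (top≡just α t) (DegreeAtMost⇒coef≡0 i α deg d i<d))

    byCmp : Tri (e < d) (e ≡ d) (d < e) → coefSum γ α d e ≡ coef α e + coef γ e
    byCmp (tri< e<d _ _) = begin
      coefSum γ α d e      ≡⟨ coefSum-< γ α e<d ⟩
      coef α e             ≡⟨ +-identityʳ (coef α e) ⟨
      coef α e + 0         ≡⟨ cong (coef α e +_) (coef-ωpow*-≢ i n λ { refl → <⇒≱ e<d d≤i }) ⟨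
      coef α e + coef γ e  ∎
    byCmp (tri≈ _ refl _) = trans (coefSum-≡ γ α e) (+-comm (coef γ e) (coef α e))
    byCmp (tri> _ _ d<e) = begin
      coefSum γ α d e      ≡⟨ coefSum-> γ α d<e ⟩
      coef γ e             ≡⟨ cong (_+ coef γ e) (proj₂ (top≡just α t) e d<e) ⟨
      coef α e + coef γ e  ∎

limAux-IsZero : ∀ m {cs} → IsZero cs → limAux m cs ≡ nothing
limAux-IsZero m []            = refl
limAux-IsZero m (refl ∷ cs≡0) rewrite limAux-IsZero m cs≡0 = refl

next-IsZero : ∀ m {α} → IsZero α → next m α ≡ nothing
next-IsZero m []            = refl
next-IsZero m (refl ∷ cs≡0) rewrite limAux-IsZero m cs≡0 = refl

limAux≡nothing⇒IsZero : ∀ m cs → limAux m cs ≡ nothing → IsZero cs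
limAux≡nothing⇒IsZero m []          _ = []
limAux≡nothing⇒IsZero m (zero ∷ cs) _ with limAux m cs in step
... | nothing = refl ∷ limAux≡nothing⇒IsZero m cs step

IsZero⊎next≡just : ∀ m α → IsZero α ⊎ ∃ λ α′ → next m α ≡ just α′
IsZero⊎next≡just m []           = inj₁ []
IsZero⊎next≡just m (suc c ∷ cs) = inj₂ (c ∷ cs , refl)
IsZero⊎next≡just m (zero ∷ cs) with limAux m cs in step
... | just r  = inj₂ (inc0 r , refl)
... | nothing = inj₁ (refl ∷ limAux≡nothing⇒IsZero m cs step)

∈𝔖-IsZero : ∀ {α} w → IsZero α → w ∈𝔖 α → w ≡ []
∈𝔖-IsZero []      _   _        = refl
∈𝔖-IsZero (m ∷ u) α≡0 (_ , u∈) with () ← subst (stepIn u) (next-IsZero m α≡0) u∈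

∷-≈o : ∀ c {cs cs′} → cs ≈o cs′ → (c ∷ cs) ≈o (c ∷ cs′)
∷-≈o c cs≈cs′ zero    = refl
∷-≈o c cs≈cs′ (suc e) = cs≈cs′ e

coef-inc0-zero : ∀ α → coef (inc0 α) 0 ≡ suc (coef α 0)
coef-inc0-zero []      = refl
coef-inc0-zero (_ ∷ _) = refl

coef-inc0-suc : ∀ α e → coef (inc0 α) (suc e) ≡ coef α (suc e)
coef-inc0-suc []      e = refl
coef-inc0-suc (_ ∷ _) e = refl

inc0-≈o : ∀ {α β} → α ≈o β → inc0 α ≈o inc0 β
inc0-≈o {α} {β} α≈β zero =
  trans (coef-inc0-zero α) (trans (cong suc (α≈β 0)) (sym (coef-inc0-zero β)))
inc0-≈o {α} {β} α≈β (suc e) =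
  trans (coef-inc0-suc α e) (trans (α≈β (suc e)) (sym (coef-inc0-suc β e)))

Pointwise-map : ∀ {f g : Ord → Ord} → (∀ {α β} → α ≈o β → f α ≈o g β) →
  ∀ {x y} → Pointwise _≈o_ x y → Pointwise _≈o_ (Maybe.map f x) (Maybe.map g y)
Pointwise-map f≈g (just α≈β) = just (f≈g α≈β)
Pointwise-map f≈g nothing    = nothing

limAux-resp-≈o : ∀ m α β → α ≈o β → Pointwise _≈o_ (limAux m α) (limAux m β)
limAux-resp-≈o m []        []        _ = nothing
limAux-resp-≈o m []        β@(_ ∷ _) α≈β
  rewrite limAux-IsZero m (coef≡0⇒IsZero β (sym ∘ α≈β)) = nothing
limAux-resp-≈o m α@(_ ∷ _) []        α≈β
  rewrite limAux-IsZero m (coef≡0⇒IsZero α α≈β) = nothing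
limAux-resp-≈o m (c ∷ cs) (c′ ∷ cs′) α≈β with α≈β 0
limAux-resp-≈o m (zero  ∷ cs) (.zero    ∷ cs′) α≈β | refl =
  Pointwise-map (∷-≈o 0) (limAux-resp-≈o m cs cs′ (α≈β ∘ suc))
limAux-resp-≈o m (suc c ∷ cs) (.(suc c) ∷ cs′) α≈β | refl =
  just (∷-≈o m (∷-≈o c (α≈β ∘ suc)))

next-resp-≈o : ∀ m α β → α ≈o β → Pointwise _≈o_ (next m α) (next m β)
next-resp-≈o m []        []        _ = nothing
next-resp-≈o m []        β@(_ ∷ _) α≈β
  rewrite next-IsZero m (coef≡0⇒IsZero β (sym ∘ α≈β)) = nothing
next-resp-≈o m α@(_ ∷ _) []        α≈β
  rewrite next-IsZero m (coef≡0⇒IsZero α α≈β) = nothing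
next-resp-≈o m (c ∷ cs) (c′ ∷ cs′) α≈β with α≈β 0
next-resp-≈o m (zero  ∷ cs) (.zero    ∷ cs′) α≈β | refl =
  Pointwise-map (λ {α} {β} → inc0-≈o {α} {β}) (limAux-resp-≈o m cs cs′ (α≈β ∘ suc))
next-resp-≈o m (suc c ∷ cs) (.(suc c) ∷ cs′) α≈β | refl =
  just (∷-≈o c (α≈β ∘ suc))

mutual
  ∈𝔖-resp-≈o : ∀ w {α β} → α ≈o β → w ∈𝔖 α → w ∈𝔖 β
  ∈𝔖-resp-≈o []      _   _ = tt
  ∈𝔖-resp-≈o (m ∷ u) {α} {β} α≈β (m≢0 , u∈) =
    m≢0 , stepIn-resp-≈o u (next-resp-≈o m α β α≈β) u∈

  stepIn-resp-≈o : ∀ u {x y} → Pointwise _≈o_ x y → stepIn u x → stepIn u y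
  stepIn-resp-≈o u (just α≈β) = ∈𝔖-resp-≈o u α≈β

∈𝔖-cong-≈o : ∀ w α β → α ≈o β → (w ∈𝔖 α) ⇔ (w ∈𝔖 β)
∈𝔖-cong-≈o w α β α≈β = mk⇔ (∈𝔖-resp-≈o w α≈β) (∈𝔖-resp-≈o w (sym ∘ α≈β))

limAux-addTerm : ∀ m n j {cs r} → DegreeAtMost j cs → limAux m cs ≡ just r →
  limAux m (addTerm j n cs) ≡ just (addTerm (suc j) n r)
limAux-addTerm m n zero    {suc c ∷ cs} _    refl = refl
limAux-addTerm m n (suc j) {suc c ∷ cs} _    refl = refl
limAux-addTerm m n zero    {zero ∷ cs}  cs≡0 eq
  with () ← trans (sym eq) (limAux-IsZero m (refl ∷ cs≡0))
limAux-addTerm m n (suc j) {zero ∷ cs}  deg  eq with limAux m cs in eq′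
... | just r′ with refl ← eq = cong (Maybe.map (0 ∷_)) (limAux-addTerm m n j deg eq′)

limAux-DegreeAtMost : ∀ m j {cs r} → DegreeAtMost j cs → limAux m cs ≡ just r →
  DegreeAtMost (suc j) r
limAux-DegreeAtMost m j       {suc c ∷ cs} deg  refl = deg
limAux-DegreeAtMost m zero    {zero ∷ cs}  cs≡0 eq
  with () ← trans (sym eq) (limAux-IsZero m (refl ∷ cs≡0))
limAux-DegreeAtMost m (suc j) {zero ∷ cs}  deg  eq with limAux m cs in eq′
... | just r′ with refl ← eq = limAux-DegreeAtMost m j {cs} deg eq′

inc0-addTerm : ∀ j n α → inc0 (addTerm (suc j) n α) ≡ addTerm (suc j) n (inc0 α)
inc0-addTerm j n []      = refl
inc0-addTerm j n (_ ∷ _) = refl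

inc0-DegreeAtMost : ∀ i α → DegreeAtMost i α → DegreeAtMost i (inc0 α)
inc0-DegreeAtMost zero    []      _   = []
inc0-DegreeAtMost (suc i) []      _   = []
inc0-DegreeAtMost i       (_ ∷ _) deg = deg

next-addTerm : ∀ m n i {α α′} → DegreeAtMost i α → next m α ≡ just α′ →
  next m (addTerm i n α) ≡ just (addTerm i n α′)
next-addTerm m n zero    {suc c ∷ cs} _    refl = refl
next-addTerm m n (suc j) {suc c ∷ cs} _    refl = refl
next-addTerm m n zero    {zero ∷ cs}  cs≡0 eq
  with () ← trans (sym eq) (next-IsZero m (refl ∷ cs≡0))
next-addTerm m n (suc j) {zero ∷ cs}  deg  eq with limAux m cs in eq′
... | just r with refl ← eq =
  trans (cong (Maybe.map inc0) (limAux-addTerm m n j deg eq′)) (cong just (inc0-addTerm j n r))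

next-DegreeAtMost : ∀ m i {α α′} → DegreeAtMost i α → next m α ≡ just α′ → DegreeAtMost i α′
next-DegreeAtMost m i       {suc c ∷ cs} deg  refl = deg
next-DegreeAtMost m zero    {zero ∷ cs}  cs≡0 eq
  with () ← trans (sym eq) (next-IsZero m (refl ∷ cs≡0))
next-DegreeAtMost m (suc j) {zero ∷ cs}  deg  eq with limAux m cs in eq′
... | just r with refl ← eq = inc0-DegreeAtMost (suc j) r (limAux-DegreeAtMost m j {cs} deg eq′)

infix 4 _∈𝔖_⊲_

_∈𝔖_⊲_ : Word → Ord → Ord → Set
w ∈𝔖 α ⊲ γ = (w ∈𝔖 α) ⊎ (Σ Word λ u → Σ Word λ v → (u ∈leaves α) × (v ∈𝔖 γ) × (w ≡ u ++ v))

module _ {m α α′} (step : next m α ≡ just α′) where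

  ∷∈𝔖⇔ : ∀ {u} → ((m ∷ u) ∈𝔖 α) ⇔ (NonZero m × u ∈𝔖 α′)
  ∷∈𝔖⇔ rewrite step = ⇔.refl

  ∷∈leaves⇔ : ∀ {u} → ((m ∷ u) ∈leaves α) ⇔ (NonZero m × u ∈leaves α′)
  ∷∈leaves⇔ = mk⇔
    (λ (mu∈ , maximal) → let (m≢0 , u∈) = Equivalence.to ∷∈𝔖⇔ mu∈ in
      m≢0 , u∈ , λ (v , v≢[] , uv∈) → maximal (v , v≢[] , Equivalence.from ∷∈𝔖⇔ (m≢0 , uv∈)))
    (λ (m≢0 , u∈ , maximal) →
      Equivalence.from ∷∈𝔖⇔ (m≢0 , u∈) ,
      λ (v , v≢[] , muv∈) → maximal (v , v≢[] , proj₂ (Equivalence.to ∷∈𝔖⇔ muv∈)))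

  []∉leaves : NonZero m → ¬ ([] ∈leaves α)
  []∉leaves m≢0 (_ , maximal) = maximal (m ∷ [] , (λ ()) , Equivalence.from ∷∈𝔖⇔ (m≢0 , tt))

  ∷∈𝔖⊲⇔ : ∀ {w γ} → (m ∷ w ∈𝔖 α ⊲ γ) ⇔ (NonZero m × w ∈𝔖 α′ ⊲ γ)
  ∷∈𝔖⊲⇔ {w} {γ} = mk⇔ to from
    where
    to : m ∷ w ∈𝔖 α ⊲ γ → NonZero m × w ∈𝔖 α′ ⊲ γ
    to (inj₁ mw∈) = let (m≢0 , w∈) = Equivalence.to ∷∈𝔖⇔ mw∈ in m≢0 , inj₁ w∈
    to (inj₂ ([] , v , []-leaf , (m≢0 , _) , refl)) = contradiction []-leaf ([]∉leaves m≢0)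
    to (inj₂ (_ ∷ u , v , mu-leaf , v∈ , refl)) =
      let (m≢0 , u-leaf) = Equivalence.to ∷∈leaves⇔ mu-leaf in
      m≢0 , inj₂ (u , v , u-leaf , v∈ , refl)

    from : NonZero m × w ∈𝔖 α′ ⊲ γ → m ∷ w ∈𝔖 α ⊲ γ
    from (m≢0 , inj₁ w∈) = inj₁ (Equivalence.from ∷∈𝔖⇔ (m≢0 , w∈))
    from (m≢0 , inj₂ (u , v , u-leaf , v∈ , refl)) =
      inj₂ (m ∷ u , v , Equivalence.from ∷∈leaves⇔ (m≢0 , u-leaf) , v∈ , refl)

[]∈leaves : ∀ {α} → IsZero α → [] ∈leaves α
[]∈leaves α≡0 = tt , λ (v , v≢[] , v∈) → v≢[] (∈𝔖-IsZero v α≡0 v∈)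

∈𝔖⊲⇔-IsZero : ∀ {α γ} w → IsZero α → (w ∈𝔖 α ⊲ γ) ⇔ (w ∈𝔖 γ)
∈𝔖⊲⇔-IsZero {α} {γ} w α≡0 = mk⇔ to (λ w∈ → inj₂ ([] , w , []∈leaves α≡0 , w∈ , refl))
  where
  to : w ∈𝔖 α ⊲ γ → w ∈𝔖 γ
  to (inj₁ w∈) rewrite ∈𝔖-IsZero w α≡0 w∈ = tt
  to (inj₂ (u , v , (u∈ , _) , v∈ , refl)) rewrite ∈𝔖-IsZero u α≡0 u∈ = v∈

∈𝔖⊲ωpow*⇔addTerm : ∀ i n {α} w → DegreeAtMost i α →
  (w ∈𝔖 α ⊲ ωpow* i n) ⇔ (w ∈𝔖 addTerm i n α)
∈𝔖⊲ωpow*⇔addTerm i n []      _ = mk⇔ (λ _ → tt) (λ _ → inj₁ tt)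
∈𝔖⊲ωpow*⇔addTerm i n {α} (m ∷ w) deg with IsZero⊎next≡just m α
... | inj₁ α≡0 =
  ⇔.trans (∈𝔖⊲⇔-IsZero (m ∷ w) α≡0)
          (∈𝔖-cong-≈o (m ∷ w) (ωpow* i n) (addTerm i n α) (ωpow*≈addTerm i n α≡0))
... | inj₂ (α′ , step) =
  ⇔.trans (∷∈𝔖⊲⇔ {α = α} step)
  (⇔.trans (⇔.refl ×-⇔ ∈𝔖⊲ωpow*⇔addTerm i n w (next-DegreeAtMost m i {α} deg step))
           (⇔.sym (∷∈𝔖⇔ {α = addTerm i n α} (next-addTerm m n i {α} deg step))))

lemma5p4 : (i n : ℕ) → i ≥ 1 → n ≥ 1 → (α : Ord) → α ≤o ωpow i →
    (w : Word) →
    ((w ∈𝔖 α) ⊎ (Σ Word λ u → Σ Word λ v → (u ∈leaves α) × (v ∈𝔖 ωpow* i n) × (w ≡ u ++ v)))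
    ⇔ (w ∈𝔖 (ωpow* i n +o α))
lemma5p4 i n _ _ α α≤ωⁱ w =
  ⇔.trans (∈𝔖⊲ωpow*⇔addTerm i n w deg)
          (⇔.sym (∈𝔖-cong-≈o w (ωpow* i n +o α) (addTerm i n α) (ωpow*+o≈addTerm i n α deg)))
  where
  deg : DegreeAtMost i α
  deg = ≤o-DegreeAtMost i α (ωpow i) α≤ωⁱ (DegreeAtMost-ωpow* i 1)
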